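{- For any positive integer $m$ and any positive integer $\Delta \leq m$ such that $(\Delta-1)m$ is even, there exists a finite simple undirected graph $G$ with maximum degree $\Delta$ and $\operatorname{adim}(G) = m$ such that $$\operatorname{adim}(G) = \frac{2(|V(G)|-1)}{\Delta+3}.$$
   Context: For vertices $u,v$ of $G$, $d(u,v)$ is the length of a shortest path between them ($\infty$ if none), and $d_1(u,v) := \min(d(u,v),2)$. A set $A \subseteq V(G)$ is an adjacency resolving set of $G$ if for any distinct $x,y \in V(G)$ there is $z \in A$ with $d_1(z,x) \neq d_1(z,y)$. The adjacency dimension $\operatorname{adim}(G)$ is the minimum cardinality of an adjacency resolving set of $G$. -}

module Defs where

open import Data.Nat using (ℕ; _≤_)
open import Data.Bool using (Bool; true; false; if_then_else_)
open import Data.Fin using (Fin; _≟_)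
open import Data.Fin.Subset using (Subset; _∈_; ∣_∣)
open import Data.Vec using (tabulate)
open import Data.Product using (Σ; _×_; ∃; ∃-syntax)
open import Relation.Nullary using (¬_; does)
open import Relation.Binary.PropositionalEquality using (_≡_; _≢_)

record Graph : Set where
  field
    order  : ℕ
    adj    : Fin order → Fin order → Bool
    symm   : ∀ u v → adj u v ≡ adj v u
    irrefl : ∀ v → adj v v ≡ false
open Graph public

nbhd : (G : Graph) → Fin (order G) → Subset (order G)
nbhd G v = tabulate (adj G v)

degree : (G : Graph) → Fin (order G) → ℕ
degree G v = ∣ nbhd G v ∣

HasMaxDegree : Graph → ℕ → Set
HasMaxDegree G Δ = (∀ v → degree G v ≤ Δ) × ∃[ v ] degree G v ≡ Δ

-- d₁(u,v) = min(d(u,v), 2): 0 if u = v, 1 if u,v adjacent, 2 otherwise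
-- (distance ≥ 2, including ∞).
d₁ : (G : Graph) → Fin (order G) → Fin (order G) → ℕ
d₁ G u v = if does (u ≟ v) then 0 else (if adj G u v then 1 else 2)

IsAdjResolving : (G : Graph) → Subset (order G) → Set
IsAdjResolving G A =
  ∀ (x y : Fin (order G)) → x ≢ y →
    ∃[ z ] (z ∈ A × d₁ G z x ≢ d₁ G z y)

Adim≡ : Graph → ℕ → Set
Adim≡ G k =
  (Σ (Subset (order G)) λ A → IsAdjResolving G A × ∣ A ∣ ≡ k)
  × (∀ (A : Subset (order G)) → IsAdjResolving G A → k ≤ ∣ A ∣)

{-# OPTIONS --safe #-}

-- Let B be adjacency resolving.  A vertex z ∈ B sees every v ∉ B at
-- d₁-distance 1 or 2, so vertices outside B are separated only by their sets of
-- neighbours in B: at most one of them has no neighbour in B, each u ∈ B is the unique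
-- B-neighbour of at most one of them, and all others have at least two B-neighbours.
-- Counting the at most |B|Δ edges between B and its complement gives
-- 2 (n − |B|) ≤ |B| Δ + |B| + 2, i.e. 2n ≤ |B| (Δ + 3) + 2.
--
-- Join m "points" to the members of a family of distinct subsets
-- ("blocks") of the points; in this bipartite graph the points resolve every pair.  The
-- blocks are the m singletons, the empty set, the c·m circulant pairs
-- {i, i + j + 1 mod m} (j < c) and, when Δ = 2c + 2 (forcing m even), the m/2 diametral
-- pairs {r, r + m/2}.  Every point then lies in exactly Δ blocks and the number of
-- vertices makes the lower bound an equality.

module Submission where

open import Defs
open import Data.Nat
  using (ℕ; zero; suc; _≤_; _<_; _*_; _+_; _∸_; z≤n; s≤s; z<s; _<?_; _≡ᵇ_; NonZero)
open import Data.Nat.Properties hiding (_≟_)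
open import Data.Nat.DivMod
open import Data.Nat.Divisibility using (_∣_; ∣m+n∣m⇒∣n; n∣m*n; ∣1⇒≡1)
open import Data.Nat.Tactic.RingSolver using (solve-∀)
open import Data.Bool using (Bool; true; false; not; _∧_; _∨_; if_then_else_; T)
open import Data.Bool.Properties using (T-≡; ∨-zeroʳ)
import Data.Bool.Properties as Bool
open import Data.Fin using (Fin; zero; suc; toℕ; fromℕ<; _↑ˡ_; _↑ʳ_; splitAt; _≟_)
open import Data.Fin.Properties
  using ( toℕ<n; toℕ-fromℕ<; toℕ-injective; ¬∀⟶∃¬
        ; splitAt-↑ˡ; splitAt-↑ʳ; splitAt⁻¹-↑ˡ; splitAt⁻¹-↑ʳ)
import Data.Fin.Properties as Fin
open import Data.Fin.Subset using (Subset; _∈_; ∣_∣)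
open import Data.Vec using (_∷_; []; lookup; tabulate)
open import Data.Vec.Properties using (lookup∘tabulate; []=⇒lookup; lookup⇒[]=)
open import Data.Product using (Σ; _×_; _,_; proj₁; proj₂; ∃-syntax)
open import Data.Sum using (_⊎_; inj₁; inj₂)
open import Data.Empty using (⊥; ⊥-elim)
open import Function using (_∘_)
open import Function.Bundles using (Equivalence)
open import Relation.Nullary using (¬_; yes; no)
open import Relation.Binary.PropositionalEquality
open import Relation.Binary.Definitions using (tri<; tri≈; tri>)
open import Algebra.Properties.CommutativeMonoid.Sum +-0-commutativeMonoid
  using (sum; sum-syntax; sum-cong-≗; ∑-distrib-+; ∑-comm)
open import Algebra.Properties.Semiring.Sum +-*-semiring using (*-distribˡ-sum; *-distribʳ-sum)
open import Algebra.Properties.CommutativeSemigroup *-commutativeSemigroup using (x∙yz≈y∙xz)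

𝟙 : Bool → ℕ
𝟙 true  = 1
𝟙 false = 0

𝟙≤1 : ∀ b → 𝟙 b ≤ 1
𝟙≤1 true  = s≤s z≤n
𝟙≤1 false = z≤n

sum-mono-≤ : ∀ {n} {f g : Fin n → ℕ} → (∀ i → f i ≤ g i) → sum f ≤ sum g
sum-mono-≤ {zero}  f≤g = z≤n
sum-mono-≤ {suc n} f≤g = +-mono-≤ (f≤g zero) (sum-mono-≤ (f≤g ∘ suc))

sum-const : ∀ n c → ∑[ i < n ] c ≡ n * c
sum-const zero    c = refl
sum-const (suc n) c = cong (c +_) (sum-const n c)

sum-zero : ∀ {n} {f : Fin n → ℕ} → (∀ i → f i ≡ 0) → sum f ≡ 0
sum-zero {n} f≡0 = trans (sum-cong-≗ f≡0) (trans (sum-const n 0) (*-zeroʳ n))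

term≤sum : ∀ {n} (f : Fin n → ℕ) i → f i ≤ sum f
term≤sum f zero    = m≤m+n _ _
term≤sum f (suc i) = ≤-trans (term≤sum (f ∘ suc) i) (m≤n+m _ _)

two-terms≤sum : ∀ {n} (f : Fin n → ℕ) {i j} → i ≢ j → f i + f j ≤ sum f
two-terms≤sum f {zero}  {zero}  i≢j = ⊥-elim (i≢j refl)
two-terms≤sum f {zero}  {suc j} i≢j = +-monoʳ-≤ (f zero) (term≤sum (f ∘ suc) j)
two-terms≤sum f {suc i} {zero}  i≢j =
  subst (_≤ sum f) (+-comm (f zero) (f (suc i)))
    (+-monoʳ-≤ (f zero) (term≤sum (f ∘ suc) i))
two-terms≤sum f {suc i} {suc j} i≢j =
  ≤-trans (two-terms≤sum (f ∘ suc) (i≢j ∘ cong suc)) (m≤n+m _ _)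

≤1⇒0or1 : ∀ {x} → x ≤ 1 → x ≡ 0 ⊎ x ≡ 1
≤1⇒0or1 z≤n       = inj₁ refl
≤1⇒0or1 (s≤s z≤n) = inj₂ refl

sum≤1 : ∀ {n} (f : Fin n → ℕ) → (∀ i → f i ≤ 1) →
        (∀ i j → 1 ≤ f i → 1 ≤ f j → i ≡ j) → sum f ≤ 1
sum≤1 {zero}  f f≤1 unique = z≤n
sum≤1 {suc n} f f≤1 unique with ≤1⇒0or1 (f≤1 zero)
... | inj₁ f0≡0 rewrite f0≡0 =
  sum≤1 (f ∘ suc) (f≤1 ∘ suc) λ i j fi fj → Fin.suc-injective (unique (suc i) (suc j) fi fj)
... | inj₂ f0≡1 rewrite f0≡1 = ≤-reflexive (cong suc (sum-zero rest≡0))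
  where
  rest≡0 : ∀ i → f (suc i) ≡ 0
  rest≡0 i with ≤1⇒0or1 (f≤1 (suc i))
  ... | inj₁ fi≡0 = fi≡0
  ... | inj₂ fi≡1
    with () ← unique zero (suc i) (≤-reflexive (sym f0≡1)) (≤-reflexive (sym fi≡1))

∣p∣≡∑lookup : ∀ {n} (p : Subset n) → ∣ p ∣ ≡ ∑[ i < n ] 𝟙 (lookup p i)
∣p∣≡∑lookup [] = refl
∣p∣≡∑lookup (true ∷ p) = cong suc (∣p∣≡∑lookup p)
∣p∣≡∑lookup (false ∷ p) = ∣p∣≡∑lookup p

∣tabulate∣≡∑ : ∀ {n} (p : Fin n → Bool) → ∣ tabulate p ∣ ≡ ∑[ i < n ] 𝟙 (p i)
∣tabulate∣≡∑ p =
  trans (∣p∣≡∑lookup (tabulate p)) (sum-cong-≗ (cong 𝟙 ∘ lookup∘tabulate p))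

d₁-≢ : ∀ G {u v} → u ≢ v → d₁ G u v ≡ (if adj G u v then 1 else 2)
d₁-≢ G {u} {v} u≢v with u ≟ v
... | yes u≡v = ⊥-elim (u≢v u≡v)
... | no  _   = refl

d₁-refl : ∀ G v → d₁ G v v ≡ 0
d₁-refl G v with v ≟ v
... | yes _   = refl
... | no  v≢v = ⊥-elim (v≢v refl)

d₁-≢0 : ∀ G {u v} → u ≢ v → d₁ G u v ≢ 0
d₁-≢0 G {u} {v} u≢v rewrite d₁-≢ G u≢v with adj G u v
... | true  = λ ()
... | false = λ ()

if-1-2-injective : ∀ {b b'} → (if b then 1 else 2) ≡ (if b' then 1 else 2) → b ≡ b'
if-1-2-injective {true}  {true}  _ = refl
if-1-2-injective {false} {false} _ = refl

module LowerBound (G : Graph) (B : Subset (order G)) (resolving : IsAdjResolving G B) where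

  private
    n = order G

  Outside : Fin n → Set
  Outside v = lookup B v ≡ false

  inB : Fin n → ℕ
  inB u = 𝟙 (lookup B u)

  outB : Fin n → ℕ
  outB u = 𝟙 (not (lookup B u))

  adjℕ : Fin n → Fin n → ℕ
  adjℕ v u = 𝟙 (adj G v u)

  neighboursInB : Fin n → ℕ
  neighboursInB v = ∑[ u < n ] (inB u * adjℕ v u)

  ∈B⇒≢outside : ∀ {w v} → w ∈ B → Outside v → w ≢ v
  ∈B⇒≢outside w∈B v∉B refl with () ← trans (sym ([]=⇒lookup w∈B)) v∉B

  outside-injective : ∀ {v v'} → Outside v → Outside v' →
                      (∀ {w} → w ∈ B → adj G w v ≡ adj G w v') → v ≡ v'
  outside-injective {v} {v'} v∉B v'∉B sameTrace with v ≟ v'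
  ... | yes v≡v' = v≡v'
  ... | no  v≢v' with resolving v v' v≢v'
  ... | w , w∈B , d≢ = ⊥-elim (d≢ (begin
    d₁ G w v                       ≡⟨ d₁-≢ G (∈B⇒≢outside w∈B v∉B) ⟩
    (if adj G w v then 1 else 2)   ≡⟨ cong (if_then 1 else 2) (sameTrace w∈B) ⟩
    (if adj G w v' then 1 else 2)  ≡⟨ d₁-≢ G (∈B⇒≢outside w∈B v'∉B) ⟨
    d₁ G w v'                      ∎))
    where open ≡-Reasoning

  isolated : Fin n → ℕ
  isolated v = 𝟙 (not (lookup B v) ∧ (neighboursInB v ≡ᵇ 0))

  pendant : Fin n → ℕ
  pendant v = 𝟙 (not (lookup B v) ∧ (neighboursInB v ≡ᵇ 1))

  private
    𝟙-outside : ∀ {x y} → 1 ≤ 𝟙 (not x ∧ y) → x ≡ false × T y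
    𝟙-outside {false} {true} _ = refl , _

    edge-term : ∀ {v u} → lookup B u ≡ true → adj G v u ≡ true → inB u * adjℕ v u ≡ 1
    edge-term u∈B vu = cong₂ (λ x y → 𝟙 x * 𝟙 y) u∈B vu

  neighbour⇒neighboursInB≥1 : ∀ {v u} → lookup B u ≡ true → adj G v u ≡ true →
                              1 ≤ neighboursInB v
  neighbour⇒neighboursInB≥1 {v} {u} u∈B vu =
    subst (_≤ neighboursInB v) (edge-term u∈B vu) (term≤sum (λ u → inB u * adjℕ v u) u)

  neighbours⇒neighboursInB≥2 : ∀ {v u w} → u ≢ w →
    lookup B u ≡ true → adj G v u ≡ true → lookup B w ≡ true → adj G v w ≡ true →
    2 ≤ neighboursInB v
  neighbours⇒neighboursInB≥2 {v} u≢w u∈B vu w∈B vw =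
    subst (_≤ neighboursInB v) (cong₂ _+_ (edge-term u∈B vu) (edge-term w∈B vw))
      (two-terms≤sum (λ u → inB u * adjℕ v u) u≢w)

  isolated-unique : ∀ v v' → 1 ≤ isolated v → 1 ≤ isolated v' → v ≡ v'
  isolated-unique v v' iso iso' with 𝟙-outside iso | 𝟙-outside iso'
  ... | v∉B , t≡0 | v'∉B , t'≡0 =
    outside-injective v∉B v'∉B λ w∈B → trans (noEdge w∈B v t≡0) (sym (noEdge w∈B v' t'≡0))
    where
    noEdge : ∀ {w} → w ∈ B → ∀ x → T (neighboursInB x ≡ᵇ 0) → adj G w x ≡ false
    noEdge {w} w∈B x t≡0 with adj G x w in xw
    ... | false = trans (symm G w x) xw
    ... | true  with () ← subst (1 ≤_) (≡ᵇ⇒≡ _ 0 t≡0)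
                            (neighbour⇒neighboursInB≥1 ([]=⇒lookup w∈B) xw)

  pendant-neighbour-unique : ∀ {v u w} → 1 ≤ pendant v →
    lookup B u ≡ true → adj G v u ≡ true → lookup B w ≡ true → adj G v w ≡ true → w ≡ u
  pendant-neighbour-unique {v} {u} {w} pend u∈B vu w∈B vw with w ≟ u
  ... | yes w≡u = w≡u
  ... | no  w≢u = ⊥-elim (<-irrefl refl (subst (2 ≤_) (≡ᵇ⇒≡ _ 1 (proj₂ (𝟙-outside pend)))
                                        (neighbours⇒neighboursInB≥2 w≢u w∈B vw u∈B vu)))

  pendant-unique : ∀ {u} → lookup B u ≡ true → ∀ v v' →
    1 ≤ pendant v → adj G v u ≡ true → 1 ≤ pendant v' → adj G v' u ≡ true → v ≡ v'
  pendant-unique {u} u∈B v v' pend vu pend' v'u =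
    outside-injective (proj₁ (𝟙-outside pend)) (proj₁ (𝟙-outside pend')) sameTrace
    where
    sameTrace : ∀ {w} → w ∈ B → adj G w v ≡ adj G w v'
    sameTrace {w} w∈B with w ≟ u | adj G v w in vw | adj G v' w in v'w
    ... | yes refl | _     | _     = trans (symm G w v) (trans vu (sym (trans (symm G w v') v'u)))
    ... | no  w≢u  | true  | _     = ⊥-elim (w≢u (pendant-neighbour-unique pend u∈B vu w∈B′ vw))
      where w∈B′ = []=⇒lookup w∈B
    ... | no  w≢u  | _     | true  = ⊥-elim (w≢u (pendant-neighbour-unique pend' u∈B v'u w∈B′ v'w))
      where w∈B′ = []=⇒lookup w∈B
    ... | no  _    | false | false = trans (symm G w v) (trans vw (sym (trans (symm G w v') v'w)))

  weighted-neighbour-count : (f : Fin n → ℕ) →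
    ∑[ v < n ] (f v * neighboursInB v) ≡ ∑[ u < n ] (inB u * ∑[ v < n ] (f v * adjℕ v u))
  weighted-neighbour-count f = begin
    ∑[ v < n ] (f v * neighboursInB v)
      ≡⟨ sum-cong-≗ (λ v → *-distribˡ-sum (f v) (λ u → inB u * adjℕ v u)) ⟩
    ∑[ v < n ] ∑[ u < n ] (f v * (inB u * adjℕ v u))
      ≡⟨ sum-cong-≗ (λ v → sum-cong-≗ (λ u → x∙yz≈y∙xz (f v) (inB u) (adjℕ v u))) ⟩
    ∑[ v < n ] ∑[ u < n ] (inB u * (f v * adjℕ v u))
      ≡⟨ ∑-comm (λ v u → inB u * (f v * adjℕ v u)) ⟩
    ∑[ u < n ] ∑[ v < n ] (inB u * (f v * adjℕ v u))
      ≡⟨ sum-cong-≗ (λ u → *-distribˡ-sum (inB u) (λ v → f v * adjℕ v u)) ⟨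
    ∑[ u < n ] (inB u * ∑[ v < n ] (f v * adjℕ v u)) ∎
    where open ≡-Reasoning

  ∣B∣≡∑inB : ∣ B ∣ ≡ sum inB
  ∣B∣≡∑inB = ∣p∣≡∑lookup B

  ∑isolated≤1 : sum isolated ≤ 1
  ∑isolated≤1 = sum≤1 isolated (λ v → 𝟙≤1 _) isolated-unique

  ∑pendant≤∣B∣ : sum pendant ≤ ∣ B ∣
  ∑pendant≤∣B∣ = begin
    sum pendant                                              ≡⟨ sum-cong-≗ pendant*count ⟨
    ∑[ v < n ] (pendant v * neighboursInB v)                 ≡⟨ weighted-neighbour-count pendant ⟩
    ∑[ u < n ] (inB u * ∑[ v < n ] (pendant v * adjℕ v u))  ≤⟨ sum-mono-≤ atMostOne ⟩
    sum inB                                                  ≡⟨ ∣B∣≡∑inB ⟨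
    ∣ B ∣                                                    ∎
    where
    open ≤-Reasoning
    𝟙x*t : ∀ x t → 𝟙 (x ∧ (t ≡ᵇ 1)) * t ≡ 𝟙 (x ∧ (t ≡ᵇ 1))
    𝟙x*t false t             = refl
    𝟙x*t true  zero          = refl
    𝟙x*t true  (suc zero)    = refl
    𝟙x*t true  (suc (suc t)) = refl
    pendant*count : ∀ v → pendant v * neighboursInB v ≡ pendant v
    pendant*count v = 𝟙x*t (not (lookup B v)) (neighboursInB v)
    pendant-edge : ∀ {v u} → 1 ≤ pendant v * adjℕ v u → 1 ≤ pendant v × adj G v u ≡ true
    pendant-edge {v} {u} p with pendant v | adj G v u
    ... | suc _ | true  = s≤s z≤n , refl
    ... | suc w | false with () ← subst (1 ≤_) (*-zeroʳ w) p
    atMostOne : ∀ u → inB u * ∑[ v < n ] (pendant v * adjℕ v u) ≤ inB u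
    atMostOne u with lookup B u in u∈B
    ... | false = z≤n
    ... | true  = ≤-trans (≤-reflexive (+-identityʳ _)) (sum≤1 _ term≤1 λ v v' p p' →
      let pend , vu = pendant-edge p ; pend' , v'u = pendant-edge p'
      in  pendant-unique u∈B v v' pend vu pend' v'u)
      where
      term≤1 : ∀ v → pendant v * adjℕ v u ≤ 1
      term≤1 v = *-mono-≤ (𝟙≤1 (not (lookup B v) ∧ _)) (𝟙≤1 (adj G v u))

  ∑outB+∑inB≡n : sum outB + sum inB ≡ n
  ∑outB+∑inB≡n = begin
    sum outB + sum inB           ≡⟨ ∑-distrib-+ outB inB ⟨
    ∑[ v < n ] (outB v + inB v)  ≡⟨ sum-cong-≗ (λ v → not-b+b (lookup B v)) ⟩
    ∑[ v < n ] 1                 ≡⟨ sum-const n 1 ⟩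
    n * 1                        ≡⟨ *-identityʳ n ⟩
    n                            ∎
    where
    open ≡-Reasoning
    not-b+b : ∀ b → 𝟙 (not b) + 𝟙 b ≡ 1
    not-b+b false = refl
    not-b+b true  = refl

  module _ (Δ : ℕ) (degree≤Δ : ∀ v → degree G v ≤ Δ) where

    ∑outB*neighboursInB≤∣B∣*Δ : ∑[ v < n ] (outB v * neighboursInB v) ≤ ∣ B ∣ * Δ
    ∑outB*neighboursInB≤∣B∣*Δ = begin
      ∑[ v < n ] (outB v * neighboursInB v)
        ≡⟨ weighted-neighbour-count outB ⟩
      ∑[ u < n ] (inB u * ∑[ v < n ] (outB v * adjℕ v u))
        ≤⟨ sum-mono-≤ (λ u → *-monoʳ-≤ (inB u) (outside-neighbours≤Δ u)) ⟩
      ∑[ u < n ] (inB u * Δ)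
        ≡⟨ *-distribʳ-sum Δ inB ⟨
      sum inB * Δ
        ≡⟨ cong (_* Δ) ∣B∣≡∑inB ⟨
      ∣ B ∣ * Δ ∎
      where
      open ≤-Reasoning
      outside-neighbours≤Δ : ∀ u → ∑[ v < n ] (outB v * adjℕ v u) ≤ Δ
      outside-neighbours≤Δ u = begin
        ∑[ v < n ] (outB v * adjℕ v u)
          ≤⟨ sum-mono-≤ (λ v → *-monoˡ-≤ (adjℕ v u) (𝟙≤1 (not (lookup B v)))) ⟩
        ∑[ v < n ] (1 * adjℕ v u)
          ≡⟨ sum-cong-≗ (λ v → trans (*-identityˡ _) (cong 𝟙 (symm G v u))) ⟩
        ∑[ v < n ] adjℕ u v
          ≡⟨ ∣tabulate∣≡∑ (adj G u) ⟨
        degree G u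
          ≤⟨ degree≤Δ u ⟩
        Δ ∎

    2*order≤∣B∣*[Δ+3]+2 : 2 * n ≤ ∣ B ∣ * (Δ + 3) + 2
    2*order≤∣B∣*[Δ+3]+2 = begin
      2 * n
        ≡⟨ cong (2 *_) ∑outB+∑inB≡n ⟨
      2 * (sum outB + sum inB)
        ≡⟨ *-distribˡ-+ 2 (sum outB) (sum inB) ⟩
      2 * sum outB + 2 * sum inB
        ≡⟨ cong₂ _+_ (*-distribˡ-sum 2 outB) (cong (2 *_) (sym ∣B∣≡∑inB)) ⟩
      ∑[ v < n ] (2 * outB v) + 2 * k
        ≤⟨ +-monoˡ-≤ (2 * k) (sum-mono-≤ (λ v → deficit (not (lookup B v)) (neighboursInB v))) ⟩
      ∑[ v < n ] (outB v * neighboursInB v + 2 * isolated v + pendant v) + 2 * k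
        ≡⟨ cong (_+ 2 * k) split ⟩
      ∑[ v < n ] (outB v * neighboursInB v) + 2 * sum isolated + sum pendant + 2 * k
        ≤⟨ +-monoˡ-≤ (2 * k) (+-mono-≤ (+-mono-≤ ∑outB*neighboursInB≤∣B∣*Δ
                                                   (*-monoʳ-≤ 2 ∑isolated≤1))
                                        ∑pendant≤∣B∣) ⟩
      k * Δ + 2 * 1 + k + 2 * k
        ≡⟨ rearrange k Δ ⟩
      k * (Δ + 3) + 2 ∎
      where
      open ≤-Reasoning
      k = ∣ B ∣
      deficit : ∀ x t → 2 * 𝟙 x ≤ 𝟙 x * t + 2 * 𝟙 (x ∧ (t ≡ᵇ 0)) + 𝟙 (x ∧ (t ≡ᵇ 1))
      deficit false t             = z≤n
      deficit true  zero          = ≤-refl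
      deficit true  (suc zero)    = ≤-refl
      deficit true  (suc (suc t)) = s≤s (s≤s z≤n)
      split : ∑[ v < n ] (outB v * neighboursInB v + 2 * isolated v + pendant v)
            ≡ ∑[ v < n ] (outB v * neighboursInB v) + 2 * sum isolated + sum pendant
      split = trans (∑-distrib-+ _ pendant) (cong (_+ sum pendant) (trans
        (∑-distrib-+ (λ v → outB v * neighboursInB v) (λ v → 2 * isolated v))
        (cong (∑[ v < n ] (outB v * neighboursInB v) +_) (sym (*-distribˡ-sum 2 isolated)))))
      rearrange : ∀ k Δ → k * Δ + 2 * 1 + k + 2 * k ≡ k * (Δ + 3) + 2
      rearrange = solve-∀

2*order≡k*[Δ+3]+2⇒k≤∣B∣ : ∀ G Δ k → (∀ v → degree G v ≤ Δ) →
                           2 * order G ≡ k * (Δ + 3) + 2 →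
                           ∀ B → IsAdjResolving G B → k ≤ ∣ B ∣
2*order≡k*[Δ+3]+2⇒k≤∣B∣ G Δ k degree≤Δ order≡ B resolving =
  *-cancelʳ-≤ k ∣ B ∣ (Δ + 3) {{nonZero}} (+-cancelʳ-≤ 2 _ _
    (subst (_≤ ∣ B ∣ * (Δ + 3) + 2) order≡ (LowerBound.2*order≤∣B∣*[Δ+3]+2 G B resolving Δ degree≤Δ)))
  where
  nonZero : NonZero (Δ + 3)
  nonZero = subst NonZero (+-comm 3 Δ) _

sum-↑ : ∀ m {n} (f : Fin (m + n) → ℕ) →
        sum f ≡ ∑[ a < m ] f (a ↑ˡ n) + ∑[ w < n ] f (m ↑ʳ w)
sum-↑ zero    f = refl
sum-↑ (suc m) f = trans (cong (f zero +_) (sum-↑ m (f ∘ suc))) (sym (+-assoc (f zero) _ _))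

module IncidenceGraph {m r : ℕ} (_∈ᵇ_ : Fin m → Fin r → Bool) where

  link : Fin m ⊎ Fin r → Fin m ⊎ Fin r → Bool
  link (inj₁ a) (inj₂ w) = a ∈ᵇ w
  link (inj₂ w) (inj₁ a) = a ∈ᵇ w
  link _        _        = false

  graph : Graph
  graph = record
    { order  = m + r
    ; adj    = λ u v → link (splitAt m u) (splitAt m v)
    ; symm   = λ u v → link-sym (splitAt m u) (splitAt m v)
    ; irrefl = λ v → link-irrefl (splitAt m v)
    }
    where
    link-sym : ∀ x y → link x y ≡ link y x
    link-sym (inj₁ _) (inj₁ _) = refl
    link-sym (inj₁ _) (inj₂ _) = refl
    link-sym (inj₂ _) (inj₁ _) = refl
    link-sym (inj₂ _) (inj₂ _) = refl
    link-irrefl : ∀ x → link x x ≡ false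
    link-irrefl (inj₁ _) = refl
    link-irrefl (inj₂ _) = refl

  isPoint : Fin m ⊎ Fin r → Bool
  isPoint (inj₁ _) = true
  isPoint (inj₂ _) = false

  points : Subset (m + r)
  points = tabulate (isPoint ∘ splitAt m)

  private
    sum-by-side : (f : Fin m ⊎ Fin r → ℕ) →
                  ∑[ v < m + r ] f (splitAt m v) ≡ ∑[ a < m ] f (inj₁ a) + ∑[ w < r ] f (inj₂ w)
    sum-by-side f = trans (sum-↑ m (f ∘ splitAt m))
      (cong₂ _+_ (sum-cong-≗ (cong f ∘ λ a → splitAt-↑ˡ m a r))
                 (sum-cong-≗ (cong f ∘ splitAt-↑ʳ m r)))

  ∣points∣ : ∣ points ∣ ≡ m
  ∣points∣ = begin
    ∣ points ∣                                ≡⟨ ∣tabulate∣≡∑ (isPoint ∘ splitAt m) ⟩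
    ∑[ v < m + r ] 𝟙 (isPoint (splitAt m v))  ≡⟨ sum-by-side (𝟙 ∘ isPoint) ⟩
    ∑[ a < m ] 1 + ∑[ w < r ] 0               ≡⟨ cong₂ _+_ (sum-const m 1) (sum-zero {r} (λ _ → refl)) ⟩
    m * 1 + 0                                 ≡⟨ trans (+-identityʳ _) (*-identityʳ m) ⟩
    m                                         ∎
    where open ≡-Reasoning

  private
    degree-via-link : ∀ u {x} → splitAt m u ≡ x →
      degree graph u ≡ ∑[ a < m ] 𝟙 (link x (inj₁ a)) + ∑[ w < r ] 𝟙 (link x (inj₂ w))
    degree-via-link u refl = trans (∣tabulate∣≡∑ (adj graph u)) (sum-by-side (𝟙 ∘ link (splitAt m u)))

  degree-point : ∀ a → degree graph (a ↑ˡ r) ≡ ∑[ w < r ] 𝟙 (a ∈ᵇ w)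
  degree-point a = trans (degree-via-link (a ↑ˡ r) (splitAt-↑ˡ m a r))
    (cong (_+ ∑[ w < r ] 𝟙 (a ∈ᵇ w)) (sum-zero {m} (λ _ → refl)))

  degree-block : ∀ w → degree graph (m ↑ʳ w) ≡ ∑[ a < m ] 𝟙 (a ∈ᵇ w)
  degree-block w = trans (degree-via-link (m ↑ʳ w) (splitAt-↑ʳ m r w))
    (trans (cong (∑[ a < m ] 𝟙 (a ∈ᵇ w) +_) (sum-zero {r} (λ _ → refl))) (+-identityʳ _))

  private
    ∈points : ∀ {x a} → splitAt m x ≡ inj₁ a → x ∈ points
    ∈points {x} x≡a =
      lookup⇒[]= x points (trans (lookup∘tabulate (isPoint ∘ splitAt m) x) (cong isPoint x≡a))

    point-separates : ∀ {x y a} → splitAt m x ≡ inj₁ a → x ≢ y → d₁ graph x x ≢ d₁ graph x y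
    point-separates {x} _ x≢y eq = d₁-≢0 graph x≢y (trans (sym eq) (d₁-refl graph x))

    d₁-point-block : ∀ {z x a w} → splitAt m z ≡ inj₁ a → splitAt m x ≡ inj₂ w →
                     d₁ graph z x ≡ (if a ∈ᵇ w then 1 else 2)
    d₁-point-block {z} {x} z≡a x≡w =
      trans (d₁-≢ graph z≢x) (cong₂ (λ p q → if link p q then 1 else 2) z≡a x≡w)
      where
      z≢x : z ≢ x
      z≢x refl with () ← trans (sym z≡a) x≡w

    same-block : ∀ {x y : Fin (m + r)} {w w'} →
                 splitAt m x ≡ inj₂ w → splitAt m y ≡ inj₂ w' → w ≡ w' → x ≡ y
    same-block x≡w y≡w refl = trans (sym (splitAt⁻¹-↑ʳ {m} {r} x≡w)) (splitAt⁻¹-↑ʳ {m} {r} y≡w)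

  points-resolving : (∀ w w' → (∀ a → a ∈ᵇ w ≡ a ∈ᵇ w') → w ≡ w') → IsAdjResolving graph points
  points-resolving blocks-distinct x y x≢y = separate (splitAt m x) (splitAt m y) refl refl
    where
    separate : ∀ sx sy → splitAt m x ≡ sx → splitAt m y ≡ sy →
               ∃[ z ] (z ∈ points × d₁ graph z x ≢ d₁ graph z y)
    separate (inj₁ a) _        x≡a _   = x , ∈points x≡a , point-separates x≡a x≢y
    separate (inj₂ _) (inj₁ b) _   y≡b = y , ∈points y≡b , point-separates y≡b (x≢y ∘ sym) ∘ sym
    separate (inj₂ w) (inj₂ w') x≡w y≡w'
      with a , a∈w≢a∈w' ← ¬∀⟶∃¬ m (λ a → a ∈ᵇ w ≡ a ∈ᵇ w')
                                   (λ a → a ∈ᵇ w Bool.≟ a ∈ᵇ w')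
                                   (λ same → x≢y (same-block x≡w y≡w' (blocks-distinct w w' same)))
      = a ↑ˡ r , ∈points (splitAt-↑ˡ m a r) , λ eq → a∈w≢a∈w' (if-1-2-injective
          (trans (sym (d₁-point-block (splitAt-↑ˡ m a r) x≡w))
                 (trans eq (d₁-point-block (splitAt-↑ˡ m a r) y≡w'))))

sumTo : ℕ → (ℕ → ℕ) → ℕ
sumTo n f = ∑[ i < n ] f (toℕ i)

syntax sumTo n (λ i → x) = ∑ℕ[ i < n ] x

sumTo-cong : ∀ n {f g : ℕ → ℕ} → (∀ i → i < n → f i ≡ g i) → sumTo n f ≡ sumTo n g
sumTo-cong n f≡g = sum-cong-≗ (λ i → f≡g (toℕ i) (toℕ<n i))

sumTo-+ : ∀ n (f g : ℕ → ℕ) → ∑ℕ[ i < n ] (f i + g i) ≡ sumTo n f + sumTo n g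
sumTo-+ n f g = ∑-distrib-+ {n} (f ∘ toℕ) (g ∘ toℕ)

sumTo-zero : ∀ n {f : ℕ → ℕ} → (∀ i → i < n → f i ≡ 0) → sumTo n f ≡ 0
sumTo-zero n f≡0 = sum-zero (λ i → f≡0 (toℕ i) (toℕ<n i))

sumTo-+-split : ∀ a b f → sumTo (a + b) f ≡ sumTo a f + ∑ℕ[ i < b ] f (a + i)
sumTo-+-split zero    b f = refl
sumTo-+-split (suc a) b f =
  trans (cong (f 0 +_) (sumTo-+-split a b (f ∘ suc))) (sym (+-assoc (f 0) _ _))

sumTo-suc-last : ∀ n f → sumTo (suc n) f ≡ sumTo n f + f n
sumTo-suc-last zero    f = +-identityʳ (f 0)
sumTo-suc-last (suc n) f =
  trans (cong (f 0 +_) (sumTo-suc-last n (f ∘ suc))) (sym (+-assoc (f 0) _ _))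

sumTo-*-blocks : ∀ c m f → sumTo (c * m) f ≡ ∑ℕ[ j < c ] ∑ℕ[ i < m ] f (j * m + i)
sumTo-*-blocks zero    m f = refl
sumTo-*-blocks (suc c) m f = trans (sumTo-+-split m (c * m) f)
  (cong (sumTo m f +_) (trans (sumTo-*-blocks c m (λ i → f (m + i)))
    (sumTo-cong c (λ j _ → sumTo-cong m (λ i _ → cong f (sym (+-assoc m (j * m) i)))))))

[m%n+o]%n≡[m+o]%n : ∀ m o n .{{_ : NonZero n}} → (m % n + o) % n ≡ (m + o) % n
[m%n+o]%n≡[m+o]%n m o n = begin
  (m % n + o) % n            ≡⟨ %-distribˡ-+ (m % n) o n ⟩
  (m % n % n + o % n) % n    ≡⟨ cong (λ x → (x + o % n) % n) (m%n%n≡m%n m n) ⟩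
  (m % n + o % n) % n        ≡⟨ %-distribˡ-+ m o n ⟨
  (m + o) % n                ∎
  where open ≡-Reasoning

[m+o]%n≢m : ∀ {m o n} .{{_ : NonZero n}} → m < n → 0 < o → o < n → (m + o) % n ≢ m
[m+o]%n≢m {m} {o} {n} m<n 0<o o<n eq with m + o <? n
... | yes m+o<n = <⇒≢ (m<m+n m 0<o) (sym (trans (sym (m<n⇒m%n≡m m+o<n)) eq))
... | no  m+o≮n = <⇒≢ r<m (begin
  r              ≡⟨ m<n⇒m%n≡m (<-trans r<m m<n) ⟨
  r % n          ≡⟨ [m+n]%n≡m%n r n ⟨
  (r + n) % n    ≡⟨ cong (_% n) r+n≡m+o ⟩
  (m + o) % n    ≡⟨ eq ⟩
  m              ∎)
  where
  open ≡-Reasoning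
  r = m + o ∸ n
  r+n≡m+o : r + n ≡ m + o
  r+n≡m+o = m∸n+n≡m (≮⇒≥ m+o≮n)
  r<m : r < m
  r<m = +-cancelʳ-< n r m (subst (_< m + n) (sym r+n≡m+o) (+-monoʳ-< m o<n))

[m*n+o]%n≡o : ∀ m {n o} .{{_ : NonZero n}} → o < n → (m * n + o) % n ≡ o
[m*n+o]%n≡o m {n} {o} o<n =
  trans (cong (_% n) (+-comm (m * n) o)) (trans ([m+kn]%n≡m%n o m n) (m<n⇒m%n≡m o<n))

[m*n+o]/n≡m : ∀ m {n o} .{{_ : NonZero n}} → o < n → (m * n + o) / n ≡ m
[m*n+o]/n≡m m {n} {o} o<n = begin
  (m * n + o) / n    ≡⟨ +-distrib-/ (m * n) o remainders<n ⟩
  m * n / n + o / n  ≡⟨ cong₂ _+_ (m*n/n≡m m n) (m<n⇒m/n≡0 o<n) ⟩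
  m + 0              ≡⟨ +-identityʳ m ⟩
  m                  ∎
  where
  open ≡-Reasoning
  remainders<n : (m * n) % n + o % n < n
  remainders<n = subst (_< n) (sym (cong₂ _+_ (m*n%n≡0 m n) (m<n⇒m%n≡m o<n))) o<n

m*n+o<p*n : ∀ {m n o p} → o < n → m < p → m * n + o < p * n
m*n+o<p*n {m} {n} {o} {p} o<n m<p = begin-strict
  m * n + o  <⟨ +-monoʳ-< (m * n) o<n ⟩
  m * n + n  ≡⟨ +-comm (m * n) n ⟩
  suc m * n  ≤⟨ *-monoˡ-≤ n m<p ⟩
  p * n      ∎
  where open ≤-Reasoning

[m+o]%n≢[m+o']%n : ∀ {m o o' n} .{{_ : NonZero n}} → o < o' → o' < n →
                   (m + o) % n ≢ (m + o') % n
[m+o]%n≢[m+o']%n {m} {o} {o'} {n} o<o' o'<n eq =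
  [m+o]%n≢m (m%n<n (m + o) n) (m<n⇒0<n∸m o<o') (≤-<-trans (m∸n≤m o' o) o'<n) (begin
    ((m + o) % n + (o' ∸ o)) % n   ≡⟨ [m%n+o]%n≡[m+o]%n (m + o) (o' ∸ o) n ⟩
    (m + o + (o' ∸ o)) % n         ≡⟨ cong (_% n) (+-assoc m o _) ⟩
    (m + (o + (o' ∸ o))) % n       ≡⟨ cong (λ x → (m + x) % n) (m+[n∸m]≡n (<⇒≤ o<o')) ⟩
    (m + o') % n                   ≡⟨ eq ⟨
    (m + o) % n                    ∎)
  where open ≡-Reasoning

[m+o]%n-injective : ∀ {m o o' n} .{{_ : NonZero n}} → o < n → o' < n →
                    (m + o) % n ≡ (m + o') % n → o ≡ o'
[m+o]%n-injective {o = o} {o'} o<n o'<n eq with <-cmp o o'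
... | tri≈ _ o≡o' _ = o≡o'
... | tri< o<o' _ _ = ⊥-elim ([m+o]%n≢[m+o']%n o<o' o'<n eq)
... | tri> _ _ o'<o = ⊥-elim ([m+o]%n≢[m+o']%n o'<o o<n (sym eq))

sumTo-rotate : ∀ m .{{_ : NonZero m}} s f → ∑ℕ[ i < m ] f ((i + s) % m) ≡ sumTo m f
sumTo-rotate m zero f =
  sumTo-cong m (λ i i<m → cong f (trans (cong (_% m) (+-identityʳ i)) (m<n⇒m%n≡m i<m)))
sumTo-rotate m@(suc k) (suc s) f = begin
  ∑ℕ[ i < m ] f ((i + suc s) % m)        ≡⟨ sumTo-cong m (λ i _ → cong f (shift i)) ⟩
  ∑ℕ[ i < m ] f (((i + s) % m + 1) % m)  ≡⟨ sumTo-rotate m s (λ x → f ((x + 1) % m)) ⟩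
  ∑ℕ[ i < m ] f ((i + 1) % m)            ≡⟨ sumTo-suc-last k (λ i → f ((i + 1) % m)) ⟩
  ∑ℕ[ i < k ] f ((i + 1) % m) + f ((k + 1) % m)
    ≡⟨ cong₂ _+_ (sumTo-cong k (λ i i<k → cong f (no-wrap i i<k))) (cong f wrap) ⟩
  ∑ℕ[ i < k ] f (suc i) + f 0            ≡⟨ +-comm _ (f 0) ⟩
  sumTo m f                              ∎
  where
  open ≡-Reasoning
  shift : ∀ i → (i + suc s) % m ≡ ((i + s) % m + 1) % m
  shift i = sym (trans ([m%n+o]%n≡[m+o]%n (i + s) 1 m)
                       (cong (_% m) (trans (+-assoc i s 1) (cong (i +_) (+-comm s 1)))))
  no-wrap : ∀ i → i < k → (i + 1) % m ≡ suc i
  no-wrap i i<k = trans (m<n⇒m%n≡m (s≤s (subst (_≤ k) (+-comm 1 i) i<k))) (+-comm i 1)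
  wrap : (k + 1) % m ≡ 0
  wrap = trans (cong (_% m) (+-comm k 1)) (n%n≡0 m)

≡ᵇ-refl : ∀ a → (a ≡ᵇ a) ≡ true
≡ᵇ-refl zero    = refl
≡ᵇ-refl (suc a) = ≡ᵇ-refl a

≡ᵇ-sym : ∀ a b → (a ≡ᵇ b) ≡ (b ≡ᵇ a)
≡ᵇ-sym zero    zero    = refl
≡ᵇ-sym zero    (suc b) = refl
≡ᵇ-sym (suc a) zero    = refl
≡ᵇ-sym (suc a) (suc b) = ≡ᵇ-sym a b

≡ᵇ-true⇒≡ : ∀ {a b} → (a ≡ᵇ b) ≡ true → a ≡ b
≡ᵇ-true⇒≡ {a} {b} eq = ≡ᵇ⇒≡ a b (Equivalence.from T-≡ eq)

𝟙-∨-disjoint : ∀ x y → (x ≡ true → y ≡ true → ⊥) → 𝟙 (x ∨ y) ≡ 𝟙 x + 𝟙 y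
𝟙-∨-disjoint true  true  disjoint = ⊥-elim (disjoint refl refl)
𝟙-∨-disjoint true  false _        = refl
𝟙-∨-disjoint false _     _        = refl

sumTo-𝟙[i≡a] : ∀ {n a} → a < n → ∑ℕ[ i < n ] 𝟙 (i ≡ᵇ a) ≡ 1
sumTo-𝟙[i≡a] {suc n} {zero}  _ = cong suc (sumTo-zero n (λ i _ → refl))
sumTo-𝟙[i≡a] {suc n} {suc a} (s≤s a<n) = sumTo-𝟙[i≡a] a<n

sumTo-𝟙[a≡i] : ∀ {n a} → a < n → ∑ℕ[ i < n ] 𝟙 (a ≡ᵇ i) ≡ 1
sumTo-𝟙[a≡i] {n} {a} a<n = trans (sumTo-cong n (λ i _ → cong 𝟙 (≡ᵇ-sym a i))) (sumTo-𝟙[i≡a] a<n)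

sumTo-two-points : ∀ {n x y} → x ≢ y → x < n → y < n →
                   ∑ℕ[ i < n ] 𝟙 ((i ≡ᵇ x) ∨ (i ≡ᵇ y)) ≡ 2
sumTo-two-points {n} {x} {y} x≢y x<n y<n = begin
  ∑ℕ[ i < n ] 𝟙 ((i ≡ᵇ x) ∨ (i ≡ᵇ y))
    ≡⟨ sumTo-cong n (λ i _ → 𝟙-∨-disjoint (i ≡ᵇ x) (i ≡ᵇ y) λ p q →
                              x≢y (trans (sym (≡ᵇ-true⇒≡ {i} p)) (≡ᵇ-true⇒≡ {i} q))) ⟩
  ∑ℕ[ i < n ] (𝟙 (i ≡ᵇ x) + 𝟙 (i ≡ᵇ y))
    ≡⟨ sumTo-+ n (λ i → 𝟙 (i ≡ᵇ x)) (λ i → 𝟙 (i ≡ᵇ y)) ⟩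
  ∑ℕ[ i < n ] 𝟙 (i ≡ᵇ x) + ∑ℕ[ i < n ] 𝟙 (i ≡ᵇ y)
    ≡⟨ cong₂ _+_ (sumTo-𝟙[i≡a] x<n) (sumTo-𝟙[i≡a] y<n) ⟩
  2 ∎
  where open ≡-Reasoning

TwoPointMatch : ℕ → ℕ → ℕ → ℕ → Set
TwoPointMatch x y x' y' = (x ≡ x' × y ≡ y') ⊎ (x ≡ y' × y ≡ x')

TwoPointMatch-sym : ∀ {x y x' y'} → TwoPointMatch x y x' y' → TwoPointMatch x' y' x y
TwoPointMatch-sym (inj₁ (p , q)) = inj₁ (sym p , sym q)
TwoPointMatch-sym (inj₂ (p , q)) = inj₂ (sym q , sym p)

two-point-sets-equal : ∀ {n x y x' y'} → x ≢ y → x < n → y < n →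
  (∀ a → a < n → ((a ≡ᵇ x) ∨ (a ≡ᵇ y)) ≡ ((a ≡ᵇ x') ∨ (a ≡ᵇ y'))) →
  TwoPointMatch x y x' y'
two-point-sets-equal {x = x} {y} {x'} {y'} x≢y x<n y<n same
  with ∨-true (trans (sym (same x x<n)) (cong (_∨ (x ≡ᵇ y)) (≡ᵇ-refl x)))
     | ∨-true (trans (sym (same y y<n)) (trans (cong ((y ≡ᵇ x) ∨_) (≡ᵇ-refl y)) (∨-zeroʳ _)))
  where
  ∨-true : ∀ {p q} → p ∨ q ≡ true → p ≡ true ⊎ q ≡ true
  ∨-true {true}  _ = inj₁ refl
  ∨-true {false} q = inj₂ q
... | inj₁ x≡x' | inj₁ y≡x' = ⊥-elim (x≢y (trans (≡ᵇ-true⇒≡ x≡x') (sym (≡ᵇ-true⇒≡ y≡x'))))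
... | inj₁ x≡x' | inj₂ y≡y' = inj₁ (≡ᵇ-true⇒≡ x≡x' , ≡ᵇ-true⇒≡ y≡y')
... | inj₂ x≡y' | inj₁ y≡x' = inj₂ (≡ᵇ-true⇒≡ x≡y' , ≡ᵇ-true⇒≡ y≡x')
... | inj₂ x≡y' | inj₂ y≡y' = ⊥-elim (x≢y (trans (≡ᵇ-true⇒≡ x≡y') (sym (≡ᵇ-true⇒≡ y≡y'))))

data Block : Set where
  single   : ℕ → Block
  pair     : ℕ → ℕ → Block
  diameter : ℕ → Block
  empty    : Block

module Construction (k c d h : ℕ) where

  m : ℕ
  m = suc k

  members : Block → ℕ → Bool
  members (single x)   a = a ≡ᵇ x
  members (pair i j)   a = (a ≡ᵇ i) ∨ (a ≡ᵇ (i + suc j) % m)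
  members (diameter r) a = (a ≡ᵇ r) ∨ (a ≡ᵇ r + h)
  members empty        a = false

  data Valid : Block → Set where
    single   : ∀ {x} → x < m → Valid (single x)
    pair     : ∀ {i j} → i < m → j < c → Valid (pair i j)
    diameter : ∀ {r} → r < d → Valid (diameter r)
    empty    : Valid empty

  #blocks : ℕ
  #blocks = m + (c * m + suc d)

  encode : Block → ℕ
  encode (single x)   = x
  encode (pair i j)   = m + (j * m + i)
  encode (diameter r) = m + (c * m + r)
  encode empty        = m + (c * m + d)

  decode-tail : ℕ → Block
  decode-tail r with r <? d
  ... | yes _ = diameter r
  ... | no  _ = empty

  decode-pairs : ℕ → Block
  decode-pairs q with q <? c * m
  ... | yes _ = pair (q % m) (q / m)
  ... | no  _ = decode-tail (q ∸ c * m)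

  decode : ℕ → Block
  decode w with w <? m
  ... | yes _ = single w
  ... | no  _ = decode-pairs (w ∸ m)

  decode-m+ : ∀ q → decode (m + q) ≡ decode-pairs q
  decode-m+ q with m + q <? m
  ... | yes m+q<m = ⊥-elim (m+n≮m m q m+q<m)
  ... | no  _     = cong decode-pairs (m+n∸m≡n m q)

  decode-pairs-cm+ : ∀ r → decode-pairs (c * m + r) ≡ decode-tail r
  decode-pairs-cm+ r with c * m + r <? c * m
  ... | yes cm+r<cm = ⊥-elim (m+n≮m (c * m) r cm+r<cm)
  ... | no  _       = cong decode-tail (m+n∸m≡n (c * m) r)

  decode-encode : ∀ {b} → Valid b → decode (encode b) ≡ b
  decode-encode (single {x} x<m) with x <? m
  ... | yes _   = refl
  ... | no  x≮m = ⊥-elim (x≮m x<m)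
  decode-encode (pair {i} {j} i<m j<c) = trans (decode-m+ (j * m + i)) pairs
    where
    pairs : decode-pairs (j * m + i) ≡ pair i j
    pairs with j * m + i <? c * m
    ... | yes _    = cong₂ pair ([m*n+o]%n≡o j i<m) ([m*n+o]/n≡m j i<m)
    ... | no  q≮cm = ⊥-elim (q≮cm (m*n+o<p*n i<m j<c))
  decode-encode (diameter {r} r<d) = trans (decode-m+ _) (trans (decode-pairs-cm+ r) tail)
    where
    tail : decode-tail r ≡ diameter r
    tail with r <? d
    ... | yes _   = refl
    ... | no  r≮d = ⊥-elim (r≮d r<d)
  decode-encode empty = trans (decode-m+ _) (trans (decode-pairs-cm+ d) tail)
    where
    tail : decode-tail d ≡ empty
    tail with d <? d
    ... | yes d<d = ⊥-elim (n≮n d d<d)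
    ... | no  _   = refl

  private
    ∸-<-offset : ∀ {w n o} → ¬ w < n → w < n + o → w ∸ n < o
    ∸-<-offset {w} {n} {o} w≮n w<n+o =
      subst (w ∸ n <_) (m+n∸m≡n n o) (∸-monoˡ-< w<n+o (≮⇒≥ w≮n))

  decode-tail-valid : ∀ {r} → r < suc d →
                      Valid (decode-tail r) × encode (decode-tail r) ≡ m + (c * m + r)
  decode-tail-valid {r} r<1+d with r <? d
  ... | yes r<d = diameter r<d , refl
  ... | no  r≮d = empty , cong (λ x → m + (c * m + x)) (≤-antisym (≮⇒≥ r≮d) (m<1+n⇒m≤n r<1+d))

  decode-pairs-valid : ∀ {q} → q < c * m + suc d →
                       Valid (decode-pairs q) × encode (decode-pairs q) ≡ m + q
  decode-pairs-valid {q} q<end with q <? c * m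
  ... | yes q<cm = pair (m%n<n q m) (m<n*o⇒m/o<n q<cm) ,
                   cong (m +_) (trans (+-comm _ (q % m)) (sym (m≡m%n+[m/n]*n q m)))
  ... | no  q≮cm with valid , encoding ← decode-tail-valid (∸-<-offset q≮cm q<end) =
    valid , trans encoding (cong (m +_) (m+[n∸m]≡n (≮⇒≥ q≮cm)))

  decode-valid : ∀ {w} → w < #blocks → Valid (decode w) × encode (decode w) ≡ w
  decode-valid {w} w<end with w <? m
  ... | yes w<m = single w<m , refl
  ... | no  w≮m with valid , encoding ← decode-pairs-valid (∸-<-offset w≮m w<end) =
    valid , trans encoding (m+[n∸m]≡n (≮⇒≥ w≮m))

  data Shape (Δ : ℕ) : Set where
    odd  : d ≡ 0 → Δ ≡ suc (c * 2) → Shape Δ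
    even : d ≡ h → m ≡ h + h → Δ ≡ suc (suc (c * 2)) → Shape Δ

  record Diametral (Δ : ℕ) : Set where
    field
      d≡h     : d ≡ h
      m≡h+h   : m ≡ h + h
      c<h     : c < h
      Δ≡2+c*2 : Δ ≡ suc (suc (c * 2))

  shape⇒1+c*2≤Δ : ∀ {Δ} → Shape Δ → suc (c * 2) ≤ Δ
  shape⇒1+c*2≤Δ (odd  _ refl)   = ≤-refl
  shape⇒1+c*2≤Δ (even _ _ refl) = n≤1+n _

  shape⇒order-equation : ∀ {Δ} → Shape Δ → 2 * (k + #blocks) ≡ m * (Δ + 3)
  shape⇒order-equation (odd d≡0 refl) rewrite d≡0 = count k c
    where
    count : ∀ k c → 2 * (k + (suc k + (c * suc k + 1))) ≡ suc k * (suc (c * 2) + 3)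
    count = solve-∀
  shape⇒order-equation (even refl m≡h+h refl) = begin
    2 * (k + #blocks)                ≡⟨ regroup k c d ⟩
    m * (c * 2 + 4) + (d + d)        ≡⟨ cong (m * (c * 2 + 4) +_) m≡h+h ⟨
    m * (c * 2 + 4) + m              ≡⟨ collect k c ⟩
    m * (suc (suc (c * 2)) + 3)      ∎
    where
    open ≡-Reasoning
    regroup : ∀ k c d → 2 * (k + (suc k + (c * suc k + suc d))) ≡ suc k * (c * 2 + 4) + (d + d)
    regroup = solve-∀
    collect : ∀ k c → suc k * (c * 2 + 4) + suc k ≡ suc k * (suc (suc (c * 2)) + 3)
    collect = solve-∀

  module _ {Δ} (Δ≤m : Δ ≤ m) where

    shape⇒diametral : Shape Δ → ∀ {r} → r < d → Diametral Δ
    shape⇒diametral (odd  refl _)         ()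
    shape⇒diametral (even d≡h m≡h+h refl) _ =
      record { d≡h = d≡h ; m≡h+h = m≡h+h ; c<h = c<h ; Δ≡2+c*2 = refl }
      where
      c<h : c < h
      c<h = *-cancelʳ-≤ (suc c) h 2 (subst₂ _≤_ (2+c*2≡[1+c]*2 c) (h+h≡h*2 h)
                                      (subst (suc (suc (c * 2)) ≤_) m≡h+h Δ≤m))
        where
        2+c*2≡[1+c]*2 : ∀ c → suc (suc (c * 2)) ≡ suc c * 2
        2+c*2≡[1+c]*2 = solve-∀
        h+h≡h*2 : ∀ h → h + h ≡ h * 2
        h+h≡h*2 = solve-∀

    module _ (shape : Shape Δ) where

      private
        1+c*2≤Δ = shape⇒1+c*2≤Δ shape

        shift<m : ∀ {j} → j < c → suc j < m
        shift<m j<c = ≤-<-trans (≤-trans j<c (m≤m*n c 2)) (≤-trans 1+c*2≤Δ Δ≤m)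

        pair-distinct : ∀ {i j} → i < m → j < c → i ≢ (i + suc j) % m
        pair-distinct i<m j<c = [m+o]%n≢m i<m z<s (shift<m j<c) ∘ sym

        pair-members : ∀ {i j} → i < m → j < c → i ≢ (i + suc j) % m × i < m × (i + suc j) % m < m
        pair-members {i} {j} i<m j<c = pair-distinct i<m j<c , i<m , m%n<n (i + suc j) m

        module Diameter {r} (r<d : r < d) where
          open Diametral (shape⇒diametral shape r<d) public
          r<h : r < h
          r<h = subst (r <_) d≡h r<d
          r+h<m : r + h < m
          r+h<m = subst (r + h <_) (sym m≡h+h) (+-monoˡ-< h r<h)
          h<m : h < m
          h<m = ≤-<-trans (m≤n+m h r) r+h<m
          r<m : r < m
          r<m = ≤-<-trans (m≤m+n r h) r+h<m
          r≢r+h : r ≢ r + h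
          r≢r+h = <⇒≢ (m<m+n r (≤-<-trans z≤n r<h))

      blockSize : Block → ℕ
      blockSize (single _)   = 1
      blockSize (pair _ _)   = 2
      blockSize (diameter _) = 2
      blockSize empty        = 0

      ∑members≡blockSize : ∀ {b} → Valid b → ∑ℕ[ a < m ] 𝟙 (members b a) ≡ blockSize b
      ∑members≡blockSize (single x<m)   = sumTo-𝟙[i≡a] x<m
      ∑members≡blockSize (pair i<m j<c) with i≢ , i<m , i′<m ← pair-members i<m j<c =
        sumTo-two-points i≢ i<m i′<m
      ∑members≡blockSize (diameter r<d) = sumTo-two-points r≢r+h r<m r+h<m
        where open Diameter r<d
      ∑members≡blockSize empty          = sumTo-zero m (λ _ _ → refl)

      blockSize≤Δ : ∀ {b} → Valid b → blockSize b ≤ Δ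
      blockSize≤Δ (single _)     = ≤-trans (s≤s z≤n) 1+c*2≤Δ
      blockSize≤Δ (pair _ j<c)   = ≤-trans (s≤s (≤-trans (≤-trans z<s j<c) (m≤m*n c 2))) 1+c*2≤Δ
      blockSize≤Δ (diameter r<d) = ≤-trans (s≤s (s≤s z≤n)) (≤-reflexive (sym Δ≡2+c*2))
        where open Diameter r<d
      blockSize≤Δ empty          = z≤n

      private
        pairs-equal : ∀ {i j i' j'} → i' < m → j < c → j' < c →
          TwoPointMatch i ((i + suc j) % m) i' ((i' + suc j') % m) → pair i j ≡ pair i' j'
        pairs-equal {i} i'<m j<c j'<c (inj₁ (refl , eq)) =
          cong (pair _) (suc-injective ([m+o]%n-injective {i} (shift<m j<c) (shift<m j'<c) eq))
        pairs-equal {i} {j} {i'} {j'} i'<m j<c j'<c (inj₂ (i≡ , eq)) =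
          ⊥-elim ([m+o]%n≢m i'<m z<s total<m (begin
            (i' + (suc j' + suc j)) % m      ≡⟨ cong (_% m) (+-assoc i' (suc j') (suc j)) ⟨
            (i' + suc j' + suc j) % m        ≡⟨ [m%n+o]%n≡[m+o]%n (i' + suc j') (suc j) m ⟨
            ((i' + suc j') % m + suc j) % m  ≡⟨ cong (λ x → (x + suc j) % m) i≡ ⟨
            (i + suc j) % m                  ≡⟨ eq ⟩
            i'                               ∎))
          where
          open ≡-Reasoning
          c+c≡c*2 : ∀ c → c + c ≡ c * 2
          c+c≡c*2 = solve-∀
          total<m : suc j' + suc j < m
          total<m = ≤-<-trans (subst (suc j' + suc j ≤_) (c+c≡c*2 c) (+-mono-≤ j'<c j<c))
                              (≤-trans 1+c*2≤Δ Δ≤m)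

        pair≢diameter : ∀ {i j r} → j < c → r < d →
          ¬ TwoPointMatch i ((i + suc j) % m) r (r + h)
        pair≢diameter {i} {j} {r} j<c r<d (inj₁ (refl , eq)) =
          <-irrefl refl (≤-<-trans (subst (_≤ c) shift≡h j<c) c<h)
          where
          open Diameter r<d
          shift≡h : suc j ≡ h
          shift≡h = [m+o]%n-injective {i} (shift<m j<c) h<m (trans eq (sym (m<n⇒m%n≡m r+h<m)))
        pair≢diameter {i} {j} {r} j<c r<d (inj₂ (refl , eq)) =
          [m+o]%n≢m r<m (≤-trans z<s (m≤n+m (suc j) h)) offset<m
            (trans (cong (_% m) (sym (+-assoc r h (suc j)))) eq)
          where
          open Diameter r<d
          offset<m : h + suc j < m
          offset<m = subst (h + suc j <_) (sym m≡h+h) (+-monoʳ-< h (≤-<-trans j<c c<h))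

        diameters-equal : ∀ {r r'} → r < d → TwoPointMatch r (r + h) r' (r' + h) → r ≡ r'
        diameters-equal r<d (inj₁ (r≡r' , _)) = r≡r'
        diameters-equal {r} {r'} r<d (inj₂ (r≡r'+h , _)) =
          ⊥-elim (<-irrefl refl (≤-trans r<h (subst (h ≤_) (sym r≡r'+h) (m≤n+m h r'))))
          where open Diameter r<d

        injective-by-size : ∀ {b b'} → Valid b → Valid b' →
          (∀ a → a < m → members b a ≡ members b' a) → blockSize b ≡ blockSize b' → b ≡ b'
        injective-by-size (single {x} x<m) (single _) same _ =
          cong single (≡ᵇ-true⇒≡ (trans (sym (same x x<m)) (≡ᵇ-refl x)))
        injective-by-size (pair i<m j<c) (pair i'<m j'<c) same _
          with i≢ , i<m , i′<m ← pair-members i<m j<c =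
          pairs-equal i'<m j<c j'<c (two-point-sets-equal i≢ i<m i′<m same)
        injective-by-size (pair i<m j<c) (diameter r<d) same _
          with i≢ , i<m , i′<m ← pair-members i<m j<c =
          ⊥-elim (pair≢diameter j<c r<d (two-point-sets-equal i≢ i<m i′<m same))
        injective-by-size (diameter r<d) (pair i<m j<c) same _ =
          ⊥-elim (pair≢diameter j<c r<d (TwoPointMatch-sym (two-point-sets-equal r≢r+h r<m r+h<m same)))
          where open Diameter r<d
        injective-by-size (diameter r<d) (diameter _) same _ =
          cong diameter (diameters-equal r<d (two-point-sets-equal r≢r+h r<m r+h<m same))
          where open Diameter r<d
        injective-by-size empty        empty        _ _  = refl
        injective-by-size (single _)   (pair _ _)   _ ()
        injective-by-size (single _)   (diameter _) _ ()
        injective-by-size (single _)   empty        _ ()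
        injective-by-size (pair _ _)   (single _)   _ ()
        injective-by-size (pair _ _)   empty        _ ()
        injective-by-size (diameter _) (single _)   _ ()
        injective-by-size (diameter _) empty        _ ()
        injective-by-size empty        (single _)   _ ()
        injective-by-size empty        (pair _ _)   _ ()
        injective-by-size empty        (diameter _) _ ()

      members-injective : ∀ {b b'} → Valid b → Valid b' →
        (∀ a → a < m → members b a ≡ members b' a) → b ≡ b'
      members-injective {b} {b'} vb vb' same = injective-by-size vb vb' same (begin
        blockSize b                    ≡⟨ ∑members≡blockSize vb ⟨
        ∑ℕ[ a < m ] 𝟙 (members b a)   ≡⟨ sumTo-cong m (λ a a<m → cong 𝟙 (same a a<m)) ⟩
        ∑ℕ[ a < m ] 𝟙 (members b' a)  ≡⟨ ∑members≡blockSize vb' ⟩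
        blockSize b'                   ∎)
        where open ≡-Reasoning

      module _ {a} (a<m : a < m) where

        private
          _∋a : Block → ℕ
          b ∋a = 𝟙 (members b a)

          decode-encode-∋a : ∀ {b} → Valid b → decode (encode b) ∋a ≡ b ∋a
          decode-encode-∋a vb = cong _∋a (decode-encode vb)

          pairs∋a : ∀ {j} → j < c → ∑ℕ[ i < m ] (pair i j ∋a) ≡ 2
          pairs∋a {j} j<c = begin
            ∑ℕ[ i < m ] 𝟙 ((a ≡ᵇ i) ∨ (a ≡ᵇ (i + suc j) % m))
              ≡⟨ sumTo-cong m (λ i i<m → 𝟙-∨-disjoint (a ≡ᵇ i) _ λ p q →
                   pair-distinct i<m j<c (trans (sym (≡ᵇ-true⇒≡ {a} p)) (≡ᵇ-true⇒≡ q))) ⟩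
            ∑ℕ[ i < m ] (𝟙 (a ≡ᵇ i) + 𝟙 (a ≡ᵇ (i + suc j) % m))
              ≡⟨ sumTo-+ m (λ i → 𝟙 (a ≡ᵇ i)) (λ i → 𝟙 (a ≡ᵇ (i + suc j) % m)) ⟩
            ∑ℕ[ i < m ] 𝟙 (a ≡ᵇ i) + ∑ℕ[ i < m ] 𝟙 (a ≡ᵇ (i + suc j) % m)
              ≡⟨ cong (∑ℕ[ i < m ] 𝟙 (a ≡ᵇ i) +_)
                      (sumTo-rotate m (suc j) (λ x → 𝟙 (a ≡ᵇ x))) ⟩
            ∑ℕ[ i < m ] 𝟙 (a ≡ᵇ i) + ∑ℕ[ i < m ] 𝟙 (a ≡ᵇ i)
              ≡⟨ cong₂ _+_ (sumTo-𝟙[a≡i] a<m) (sumTo-𝟙[a≡i] a<m) ⟩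
            2 ∎
            where open ≡-Reasoning

          diameters∋a : Shape Δ → 1 + (c * 2 + ∑ℕ[ r < d ] (diameter r ∋a)) ≡ Δ
          diameters∋a (odd d≡0 refl) =
            trans (cong (λ n → 1 + (c * 2 + ∑ℕ[ r < n ] (diameter r ∋a))) d≡0) (cong suc (+-identityʳ _))
          diameters∋a (even d≡h m≡h+h refl) = trans (cong (λ n → 1 + (c * 2 + n)) (begin
            ∑ℕ[ r < d ] 𝟙 ((a ≡ᵇ r) ∨ (a ≡ᵇ r + h))
              ≡⟨ cong (λ n → ∑ℕ[ r < n ] 𝟙 ((a ≡ᵇ r) ∨ (a ≡ᵇ r + h))) d≡h ⟩
            ∑ℕ[ r < h ] 𝟙 ((a ≡ᵇ r) ∨ (a ≡ᵇ r + h))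
              ≡⟨ sumTo-cong h (λ r r<h → 𝟙-∨-disjoint (a ≡ᵇ r) _ λ p q →
                   Diameter.r≢r+h (subst (r <_) (sym d≡h) r<h)
                                  (trans (sym (≡ᵇ-true⇒≡ {a} p)) (≡ᵇ-true⇒≡ q))) ⟩
            ∑ℕ[ r < h ] (𝟙 (a ≡ᵇ r) + 𝟙 (a ≡ᵇ r + h))
              ≡⟨ sumTo-+ h (λ r → 𝟙 (a ≡ᵇ r)) (λ r → 𝟙 (a ≡ᵇ r + h)) ⟩
            ∑ℕ[ r < h ] 𝟙 (a ≡ᵇ r) + ∑ℕ[ r < h ] 𝟙 (a ≡ᵇ r + h)
              ≡⟨ cong (∑ℕ[ r < h ] 𝟙 (a ≡ᵇ r) +_)
                      (sumTo-cong h (λ r _ → cong (λ x → 𝟙 (a ≡ᵇ x)) (+-comm r h))) ⟩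
            ∑ℕ[ r < h ] 𝟙 (a ≡ᵇ r) + ∑ℕ[ r < h ] 𝟙 (a ≡ᵇ h + r)
              ≡⟨ sumTo-+-split h h (λ x → 𝟙 (a ≡ᵇ x)) ⟨
            ∑ℕ[ x < h + h ] 𝟙 (a ≡ᵇ x)
              ≡⟨ sumTo-𝟙[a≡i] (subst (a <_) m≡h+h a<m) ⟩
            1 ∎)) (cong suc (+-comm (c * 2) 1))
            where open ≡-Reasoning

        point-degree : ∑ℕ[ w < #blocks ] (decode w ∋a) ≡ Δ
        point-degree = begin
          ∑ℕ[ w < #blocks ] (decode w ∋a)
            ≡⟨ sumTo-+-split m (c * m + suc d) (λ w → decode w ∋a) ⟩
          ∑ℕ[ x < m ] (decode x ∋a) + ∑ℕ[ q < c * m + suc d ] (decode (m + q) ∋a)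
            ≡⟨ cong (∑ℕ[ x < m ] (decode x ∋a) +_)
                    (sumTo-+-split (c * m) (suc d) (λ q → decode (m + q) ∋a)) ⟩
          ∑ℕ[ x < m ] (decode x ∋a)
            + (∑ℕ[ q < c * m ] (decode (m + q) ∋a) + ∑ℕ[ r < suc d ] (decode (m + (c * m + r)) ∋a))
            ≡⟨ cong₂ _+_ singles (cong₂ _+_ pairs tail) ⟩
          1 + (c * 2 + ∑ℕ[ r < d ] (diameter r ∋a))
            ≡⟨ diameters∋a shape ⟩
          Δ ∎
          where
          open ≡-Reasoning
          singles : ∑ℕ[ x < m ] (decode x ∋a) ≡ 1
          singles = trans (sumTo-cong m (λ x x<m → decode-encode-∋a (single x<m))) (sumTo-𝟙[a≡i] a<m)
          pairs : ∑ℕ[ q < c * m ] (decode (m + q) ∋a) ≡ c * 2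
          pairs = begin
            ∑ℕ[ q < c * m ] (decode (m + q) ∋a)
              ≡⟨ sumTo-*-blocks c m (λ q → decode (m + q) ∋a) ⟩
            ∑ℕ[ j < c ] ∑ℕ[ i < m ] (decode (m + (j * m + i)) ∋a)
              ≡⟨ sumTo-cong c (λ j j<c → trans (sumTo-cong m (λ i i<m → decode-encode-∋a (pair i<m j<c)))
                                              (pairs∋a j<c)) ⟩
            ∑ℕ[ j < c ] 2
              ≡⟨ sum-const c 2 ⟩
            c * 2 ∎
          tail : ∑ℕ[ r < suc d ] (decode (m + (c * m + r)) ∋a) ≡ ∑ℕ[ r < d ] (diameter r ∋a)
          tail = begin
            ∑ℕ[ r < suc d ] (decode (m + (c * m + r)) ∋a)
              ≡⟨ sumTo-suc-last d (λ r → decode (m + (c * m + r)) ∋a) ⟩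
            ∑ℕ[ r < d ] (decode (m + (c * m + r)) ∋a) + (decode (m + (c * m + d)) ∋a)
              ≡⟨ cong₂ _+_ (sumTo-cong d (λ r r<d → decode-encode-∋a (diameter r<d)))
                           (decode-encode-∋a empty) ⟩
            ∑ℕ[ r < d ] (diameter r ∋a) + 0
              ≡⟨ +-identityʳ _ ⟩
            ∑ℕ[ r < d ] (diameter r ∋a) ∎

      _∈ᵇ_ : Fin m → Fin #blocks → Bool
      a ∈ᵇ w = members (decode (toℕ w)) (toℕ a)

      open IncidenceGraph _∈ᵇ_

      degree≤Δ : ∀ v → degree graph v ≤ Δ
      degree≤Δ v = bound (splitAt m v) refl
        where
        bound : ∀ s → splitAt m v ≡ s → degree graph v ≤ Δ
        bound (inj₁ a) v≡a = subst (λ u → degree graph u ≤ Δ) (splitAt⁻¹-↑ˡ {m} {#blocks} {v} v≡a)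
          (≤-reflexive (trans (degree-point a) (point-degree (toℕ<n a))))
        bound (inj₂ w) v≡w = subst (λ u → degree graph u ≤ Δ) (splitAt⁻¹-↑ʳ {m} {#blocks} {v} v≡w)
          (≤-trans (≤-reflexive (trans (degree-block w) (∑members≡blockSize valid))) (blockSize≤Δ valid))
          where valid = proj₁ (decode-valid (toℕ<n w))

      blocks-distinct : ∀ w w' → (∀ a → a ∈ᵇ w ≡ a ∈ᵇ w') → w ≡ w'
      blocks-distinct w w' same = toℕ-injective (begin
        toℕ w                     ≡⟨ proj₂ (decode-valid (toℕ<n w)) ⟨
        encode (decode (toℕ w))   ≡⟨ cong encode (members-injective (proj₁ (decode-valid (toℕ<n w)))
                                                   (proj₁ (decode-valid (toℕ<n w'))) same′) ⟩
        encode (decode (toℕ w'))  ≡⟨ proj₂ (decode-valid (toℕ<n w')) ⟩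
        toℕ w'                    ∎)
        where
        open ≡-Reasoning
        same′ : ∀ a → a < m → members (decode (toℕ w)) a ≡ members (decode (toℕ w')) a
        same′ a a<m = subst (λ x → members (decode (toℕ w)) x ≡ members (decode (toℕ w')) x)
                            (toℕ-fromℕ< a<m) (same (fromℕ< a<m))

      realisation : Σ Graph λ G → HasMaxDegree G Δ × Adim≡ G m × 2 * (order G ∸ 1) ≡ m * (Δ + 3)
      realisation = graph
        , (degree≤Δ , zero ↑ˡ #blocks , trans (degree-point zero) (point-degree z<s))
        , ((points , points-resolving blocks-distinct , ∣points∣) ,
           2*order≡k*[Δ+3]+2⇒k≤∣B∣ graph Δ m degree≤Δ 2*order≡)
        , shape⇒order-equation shape
        where
        2*order≡ : 2 * order graph ≡ m * (Δ + 3) + 2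
        2*order≡ = trans (*-suc 2 (k + #blocks))
                         (trans (+-comm 2 _) (cong (_+ 2) (shape⇒order-equation shape)))

even-or-odd : ∀ n → (∃[ q ] n ≡ q * 2) ⊎ (∃[ q ] n ≡ suc (q * 2))
even-or-odd zero = inj₁ (0 , refl)
even-or-odd (suc n) with even-or-odd n
... | inj₁ (q , refl) = inj₂ (q , refl)
... | inj₂ (q , refl) = inj₁ (suc q , refl)

odd*odd-odd : ∀ p q → ¬ 2 ∣ suc (p * 2) * suc (q * 2)
odd*odd-odd p q 2∣product =
  2≢1 (∣1⇒≡1 (∣m+n∣m⇒∣n (subst (2 ∣_) (expand p q) 2∣product) (n∣m*n (p + q + p * q * 2))))
  where
  2≢1 : 2 ≢ 1
  2≢1 ()
  expand : ∀ p q → suc (p * 2) * suc (q * 2) ≡ (p + q + p * q * 2) * 2 + 1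
  expand = solve-∀

theorem3p1 : (m Δ : ℕ) → 1 ≤ m → 1 ≤ Δ → Δ ≤ m → 2 ∣ ((Δ ∸ 1) * m) →
    Σ Graph λ G → HasMaxDegree G Δ × Adim≡ G m
    × 2 * (order G ∸ 1) ≡ m * (Δ + 3)
theorem3p1 (suc k) (suc δ) _ _ Δ≤m 2∣δm with even-or-odd δ
... | inj₁ (c , refl) = Construction.realisation k c 0 0 Δ≤m (Construction.odd refl refl)
... | inj₂ (c , refl) with even-or-odd (suc k)
...   | inj₁ (h , m≡h*2) = Construction.realisation k c h h Δ≤m (Construction.even refl m≡h+h refl)
  where m≡h+h = trans m≡h*2 (trans (*-comm h 2) (cong (h +_) (+-identityʳ h)))
...   | inj₂ (q , m≡odd) = ⊥-elim (odd*odd-odd c q (subst (λ x → 2 ∣ suc (c * 2) * x) m≡odd 2∣δm))
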